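{- For every integer $n\ge 2$, $RR(A_2,C_n)=n$.
   Context: For a positive integer $N$, $\mathcal{B}_N$ denotes the Boolean lattice of all subsets of $[N]=\{1,\dots,N\}$ ordered by inclusion. A family $\mathcal{G}$ of sets is a copy of a poset $P$ if there is a bijection $\phi:P\to\mathcal{G}$ with $x<_P y$ if and only if $\phi(x)\subsetneq\phi(y)$. A coloring of $\mathcal{B}_N$ is any map from $\mathcal{B}_N$ to the positive integers. Under a coloring, a monochromatic $P$ is a copy of $P$ all of whose sets have the same color, and a rainbow $Q$ is a copy of $Q$ whose sets have pairwise distinct colors. $RR(P,Q)$ is the minimum integer $N$ such that every coloring of $\mathcal{B}_N$ contains a monochromatic $P$ or a rainbow $Q$. $C_k$ denotes the chain with $k$ elements and $A_k$ the antichain with $k$ elements. -}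

module Defs where

open import Data.Nat using (ℕ; suc; _≤_; _<_)
open import Data.Fin using (Fin) renaming (_<_ to _<ᶠ_)
open import Data.Fin.Subset using (Subset; _⊆_; _⊈_)
open import Data.Product using (Σ; ∃; _×_)
open import Data.Sum using (_⊎_)
open import Relation.Binary.PropositionalEquality using (_≡_; _≢_)

_⊊_ : {N : ℕ} → Subset N → Subset N → Set
X ⊊ Y = X ⊆ Y × X ≢ Y

-- A coloring of the Boolean lattice B_N (colors are natural numbers;
-- equivalent to positive integers via suc).
Coloring : ℕ → Set
Coloring N = Subset N → ℕ

-- A copy of the chain C_k in B_N: an order embedding Fin k → B_N,
-- i.e. i < j ⇒ φ i ⊊ φ j (the converse then follows automatically).
IsChainCopy : {N k : ℕ} → (Fin k → Subset N) → Set
IsChainCopy {N} {k} φ = ∀ (i j : Fin k) → i <ᶠ j → φ i ⊊ φ j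

IsA2Copy : {N : ℕ} → Subset N → Subset N → Set
IsA2Copy X Y = X ⊈ Y × Y ⊈ X

MonochromaticA2 : {N : ℕ} → Coloring N → Set
MonochromaticA2 {N} c = Σ (Subset N) λ X → Σ (Subset N) λ Y →
  IsA2Copy X Y × c X ≡ c Y

RainbowChain : {N : ℕ} → ℕ → Coloring N → Set
RainbowChain {N} k c = Σ (Fin k → Subset N) λ φ →
  IsChainCopy φ × (∀ (i j : Fin k) → i ≢ j → c (φ i) ≢ c (φ j))

ArrowsA2Ck : ℕ → ℕ → Set
ArrowsA2Ck k N = ∀ (c : Coloring N) → MonochromaticA2 c ⊎ RainbowChain k c

RR-A2-C-is : ℕ → ℕ → Set
RR-A2-C-is k m = 1 ≤ m × ArrowsA2Ck k m × (∀ N → 1 ≤ N → ArrowsA2Ck k N → m ≤ N)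

-- Upper bound: if no A₂ is monochromatic, every colour class is a chain. Given B ≠ [N],
-- let M be the largest set ≠ [N] with the colour of B and pick x ∉ M; then no set
-- ≠ [N] containing B ∪ {x} has the colour of B. So B can be put below a rainbow chain
-- built above B ∪ {x}, and starting from ∅ this yields a rainbow chain of N sets.
-- Lower bound: give ∅ and [N] the same colour and every other set its own colour.
-- Two incomparable sets are neither ∅ nor [N], so there is no monochromatic A₂, and
-- when N < n a chain of n sets in B_N must contain both ∅ and [N].

module Submission where

open import Defs
open import Data.Nat using (ℕ; zero; suc; _+_; _≤_; _<_; z≤n; s≤s; _≟_)
open import Data.Nat.Properties
  using (module ≤-Reasoning; ≤-refl; ≤-trans; ≤-antisym; ≤-reflexive; ≰⇒>; +-identityʳ; +-suc; +-monoˡ-≤;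
         +-cancelʳ-≤; n≤0⇒n≡0; m≤n+m; m+1+n≰m; n≤1+n)
open import Data.Nat.Binary using (ℕᵇ; 2[1+_]; 1+[2_]) renaming (zero to 0ᵇ; toℕ to ℕᵇ-toℕ)
open import Data.Nat.Binary.Properties using (2[1+_]-injective; 1+[2_]-injective) renaming (toℕ-injective to ℕᵇ-toℕ-injective)
open import Data.Bool using () renaming (_≟_ to _≟ᵇ_)
open import Data.Vec using ([]; _∷_; here)
open import Data.Vec.Properties using (≡-dec)
open import Data.Vec.Functional using () renaming (_∷_ to _◃_)
open import Data.Fin using (Fin; zero; suc; toℕ; fromℕ)
open import Data.Fin.Properties using (any?; toℕ-fromℕ)
open import Data.Fin.Subset using (Subset; _⊆_; _∈_; _∉_; _⊂_; ⊥; ⊤; _∪_; ⁅_⁆; ∣_∣; inside; outside)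
open import Data.Fin.Subset.Properties
  using (_⊆?_; _∈?_; anySubset?; ⊆-refl; ⊆-reflexive; ⊆-antisym; ⊆⊤; drop-∷-⊆; s⊆s;
         p⊂q⇒∣p∣<∣q∣; ∣p∣≤n; ∣⊥∣≡0; ∣⊤∣≡n; ∣p∣≡n⇒p≡⊤; ∪-identityʳ; p⊆p∪q; q⊆p∪q; x∈⁅x⁆)
open import Data.Product using (∃; _×_; _,_; proj₁; proj₂)
open import Data.Sum using (_⊎_; inj₁; inj₂)
import Data.Sum as Sum
open import Function using (_∘_)
open import Relation.Nullary using (¬_; Dec; yes; no; contradiction)
open import Relation.Nullary.Decidable using (¬?; _×-dec_; decidable-stable)
open import Relation.Unary using (Pred; Decidable; Satisfiable)
open import Relation.Binary.PropositionalEquality using (_≡_; _≢_; refl; sym; trans; cong; subst)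
open import Relation.Binary.PropositionalEquality.Properties using (module ≡-Reasoning)

private
  variable
    n N k : ℕ

Rainbow : Coloring N → (Fin k → Subset N) → Set
Rainbow c φ = ∀ i j → i ≢ j → c (φ i) ≢ c (φ j)

_≟ˢ_ : (p q : Subset n) → Dec (p ≡ q)
_≟ˢ_ = ≡-dec _≟ᵇ_

⊊⇒⊂ : {X Y : Subset n} → X ⊊ Y → X ⊂ Y
⊊⇒⊂ {X = X} {Y} (X⊆Y , X≢Y) with any? (λ x → x ∈? Y ×-dec ¬? (x ∈? X))
... | yes witness = X⊆Y , witness
... | no ∄witness = contradiction (⊆-antisym X⊆Y Y⊆X) X≢Y
  where
  Y⊆X : Y ⊆ X
  Y⊆X {x} x∈Y = decidable-stable (x ∈? X) (λ x∉X → ∄witness (x , x∈Y , x∉X))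

⊊⇒∣∣< : {X Y : Subset n} → X ⊊ Y → ∣ X ∣ < ∣ Y ∣
⊊⇒∣∣< = p⊂q⇒∣p∣<∣q∣ ∘ ⊊⇒⊂

≢⊤⇒∃∉ : {M : Subset n} → M ≢ ⊤ → ∃ λ x → x ∉ M
≢⊤⇒∃∉ {M = M} M≢⊤ with any? (λ x → ¬? (x ∈? M))
... | yes witness = witness
... | no ∄witness = contradiction (⊆-antisym ⊆⊤ ⊤⊆M) M≢⊤
  where
  ⊤⊆M : ⊤ ⊆ M
  ⊤⊆M {x} _ = decidable-stable (x ∈? M) (λ x∉M → ∄witness (x , x∉M))

∣p∣≡0⇒p≡⊥ : (p : Subset n) → ∣ p ∣ ≡ 0 → p ≡ ⊥
∣p∣≡0⇒p≡⊥ []            _     = refl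
∣p∣≡0⇒p≡⊥ (outside ∷ p) ∣p∣≡0 = cong (outside ∷_) (∣p∣≡0⇒p≡⊥ p ∣p∣≡0)

∣p∪⁅x⁆∣≤1+∣p∣ : (p : Subset n) (x : Fin n) → ∣ p ∪ ⁅ x ⁆ ∣ ≤ suc ∣ p ∣
∣p∪⁅x⁆∣≤1+∣p∣ (inside  ∷ p) zero    rewrite ∪-identityʳ p = n≤1+n _
∣p∪⁅x⁆∣≤1+∣p∣ (outside ∷ p) zero    rewrite ∪-identityʳ p = ≤-refl
∣p∪⁅x⁆∣≤1+∣p∣ (inside  ∷ p) (suc x) = s≤s (∣p∪⁅x⁆∣≤1+∣p∣ p x)
∣p∪⁅x⁆∣≤1+∣p∣ (outside ∷ p) (suc x) = ∣p∪⁅x⁆∣≤1+∣p∣ p x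

room⇒≢⊤ : (B : Subset N) → ∣ B ∣ + suc k ≤ N → B ≢ ⊤
room⇒≢⊤ {N = N} {k = k} _ room refl = m+1+n≰m N (subst (λ t → t + suc k ≤ N) (∣⊤∣≡n N) room)

PairwiseComparable : ∀ {ℓ} → Pred (Subset n) ℓ → Set ℓ
PairwiseComparable P = ∀ {X Y} → P X → P Y → X ⊆ Y ⊎ Y ⊆ X

HasMaximum : ∀ {ℓ} → Pred (Subset n) ℓ → Set ℓ
HasMaximum P = ∃ λ M → P M × (∀ {Y} → P Y → Y ⊆ M)

∷-pairwiseComparable : ∀ {ℓ} {P : Pred (Subset (suc n)) ℓ} →
                       PairwiseComparable P → ∀ b → PairwiseComparable (P ∘ (b ∷_))
∷-pairwiseComparable comparable b PX PY = Sum.map drop-∷-⊆ drop-∷-⊆ (comparable PX PY)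

-- If some member starts with inside, the maximum starts with inside too: a member
-- starting with outside cannot contain it, so by comparability lies below it.
chain-maximum : ∀ {ℓ} {P : Pred (Subset n) ℓ} → Decidable P →
                PairwiseComparable P → ∃⟨ P ⟩ → HasMaximum P
chain-maximum {zero} P? comparable ([] , P[]) = [] , P[] , λ { {[]} _ → ⊆-refl }
chain-maximum {suc n} {P = P} P? comparable (b ∷ p , Pbp) with anySubset? (P? ∘ (inside ∷_))
... | yes ∃inside =
  insideMaximum (chain-maximum (P? ∘ (inside ∷_)) (∷-pairwiseComparable comparable inside) ∃inside)
  where
  insideMaximum : HasMaximum (P ∘ (inside ∷_)) → HasMaximum P
  insideMaximum (m , Pm , max) = inside ∷ m , Pm , λ {Y} → below Y
    where
    below : ∀ Y → P Y → Y ⊆ inside ∷ m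
    below (inside  ∷ q) Pq = s⊆s (max Pq)
    below (outside ∷ q) Pq with comparable Pq Pm
    ... | inj₁ Y⊆M = Y⊆M
    ... | inj₂ M⊆Y = contradiction (M⊆Y here) λ ()
... | no ∄inside =
  outsideMaximum (chain-maximum (P? ∘ (outside ∷_)) (∷-pairwiseComparable comparable outside)
                                (p , outsideWitness b Pbp))
  where
  outsideWitness : ∀ b → P (b ∷ p) → P (outside ∷ p)
  outsideWitness inside  Pp = contradiction (p , Pp) ∄inside
  outsideWitness outside Pp = Pp
  outsideMaximum : HasMaximum (P ∘ (outside ∷_)) → HasMaximum P
  outsideMaximum (m , Pm , max) = outside ∷ m , Pm , λ {Y} → below Y
    where
    below : ∀ Y → P Y → Y ⊆ outside ∷ m
    below (inside  ∷ q) Pq = contradiction (q , Pq) ∄inside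
    below (outside ∷ q) Pq = s⊆s (max Pq)

tail-isChainCopy : {φ : Fin (suc k) → Subset N} → IsChainCopy φ → IsChainCopy (φ ∘ suc)
tail-isChainCopy chain i j i<j = chain (suc i) (suc j) (s≤s i<j)

◃-isChainCopy : {B : Subset N} {φ : Fin k → Subset N} →
                (∀ j → B ⊊ φ j) → IsChainCopy φ → IsChainCopy (B ◃ φ)
◃-isChainCopy B⊊φ chain zero    (suc j) _         = B⊊φ j
◃-isChainCopy B⊊φ chain (suc i) (suc j) (s≤s i<j) = chain i j i<j

◃-rainbow : {c : Coloring N} {B : Subset N} {φ : Fin k → Subset N} →
            (∀ j → c (φ j) ≢ c B) → Rainbow c φ → Rainbow c (B ◃ φ)
◃-rainbow fresh rainbow zero    zero    0≢0 = contradiction refl 0≢0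
◃-rainbow fresh rainbow zero    (suc j) _   = fresh j ∘ sym
◃-rainbow fresh rainbow (suc i) zero    _   = fresh i
◃-rainbow fresh rainbow (suc i) (suc j) i≢j = rainbow i j (i≢j ∘ cong suc)

chainCopy-∣∣ : {φ : Fin (suc k) → Subset N} → IsChainCopy φ →
               ∀ i → ∣ φ zero ∣ + toℕ i ≤ ∣ φ i ∣
chainCopy-∣∣ {φ = φ} _ zero = ≤-reflexive (+-identityʳ ∣ φ zero ∣)
chainCopy-∣∣ {k = suc k} {φ = φ} chain (suc i) = begin
  ∣ φ zero ∣ + suc (toℕ i)    ≡⟨ +-suc ∣ φ zero ∣ (toℕ i) ⟩
  suc ∣ φ zero ∣ + toℕ i      ≤⟨ +-monoˡ-≤ (toℕ i) (⊊⇒∣∣< (chain zero (suc zero) (s≤s z≤n))) ⟩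
  ∣ φ (suc zero) ∣ + toℕ i    ≤⟨ chainCopy-∣∣ (tail-isChainCopy chain) i ⟩
  ∣ φ (suc i) ∣               ∎
  where open ≤-Reasoning

chainCopy-spans : {φ : Fin (suc k) → Subset N} → N ≤ k → IsChainCopy φ →
                  φ zero ≡ ⊥ × φ (fromℕ k) ≡ ⊤
chainCopy-spans {k = k} {N = N} {φ = φ} N≤k chain =
  ∣p∣≡0⇒p≡⊥ (φ zero) (n≤0⇒n≡0 (+-cancelʳ-≤ k ∣ φ zero ∣ 0 ∣φ₀∣+k≤k)) ,
  ∣p∣≡n⇒p≡⊤ (≤-antisym (∣p∣≤n (φ last)) N≤∣φlast∣)
  where
  last : Fin (suc k)
  last = fromℕ k
  ∣φ₀∣+k≤∣φlast∣ : ∣ φ zero ∣ + k ≤ ∣ φ last ∣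
  ∣φ₀∣+k≤∣φlast∣ = subst (λ t → ∣ φ zero ∣ + t ≤ ∣ φ last ∣) (toℕ-fromℕ k) (chainCopy-∣∣ chain last)
  ∣φ₀∣+k≤k : ∣ φ zero ∣ + k ≤ k
  ∣φ₀∣+k≤k = ≤-trans ∣φ₀∣+k≤∣φlast∣ (≤-trans (∣p∣≤n (φ last)) N≤k)
  N≤∣φlast∣ : N ≤ ∣ φ last ∣
  N≤∣φlast∣ = ≤-trans N≤k (≤-trans (m≤n+m k ∣ φ zero ∣) ∣φ₀∣+k≤∣φlast∣)

monochromaticA2? : (c : Coloring N) → Dec (MonochromaticA2 c)
monochromaticA2? c = anySubset? λ X → anySubset? λ Y →
  (¬? (X ⊆? Y) ×-dec ¬? (Y ⊆? X)) ×-dec (c X ≟ c Y)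

module Greedy (c : Coloring N) (noA2 : ¬ MonochromaticA2 c) where

  sameColour-comparable : {X Y : Subset N} → c X ≡ c Y → X ⊆ Y ⊎ Y ⊆ X
  sameColour-comparable {X} {Y} cX≡cY with X ⊆? Y | Y ⊆? X
  ... | yes X⊆Y | _       = inj₁ X⊆Y
  ... | no _    | yes Y⊆X = inj₂ Y⊆X
  ... | no X⊈Y  | no Y⊈X  = contradiction (X , Y , (X⊈Y , Y⊈X) , cX≡cY) noA2

  escape : {B : Subset N} → B ≢ ⊤ →
           ∃ λ x → x ∉ B × (∀ {Y} → x ∈ Y → Y ≢ ⊤ → c Y ≢ c B)
  escape {B} B≢⊤ =
    let (M , (_ , M≢⊤) , maximal) = colourClassMaximum
        (x , x∉M) = ≢⊤⇒∃∉ M≢⊤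
    in x , x∉M ∘ maximal (refl , B≢⊤) , λ x∈Y Y≢⊤ cY≡cB → x∉M (maximal (cY≡cB , Y≢⊤) x∈Y)
    where
    ColourClass : Pred (Subset N) _
    ColourClass Y = c Y ≡ c B × Y ≢ ⊤
    colourClassMaximum : HasMaximum ColourClass
    colourClassMaximum = chain-maximum (λ Y → (c Y ≟ c B) ×-dec ¬? (Y ≟ˢ ⊤))
      (λ (cX≡cB , _) (cY≡cB , _) → sameColour-comparable (trans cX≡cB (sym cY≡cB)))
      (B , refl , B≢⊤)

  rainbowChainAbove : ∀ k (B : Subset N) → ∣ B ∣ + k ≤ N →
    ∃ λ (φ : Fin k → Subset N) → IsChainCopy φ × Rainbow c φ × (∀ i → B ⊆ φ i × φ i ≢ ⊤)
  rainbowChainAbove zero    B _ = (λ ()) , (λ ()) , (λ ()) , (λ ())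
  rainbowChainAbove (suc k) B room with escape (room⇒≢⊤ B room)
  ... | x , x∉B , fresh with rainbowChainAbove k (B ∪ ⁅ x ⁆) room′
    where
    room′ : ∣ B ∪ ⁅ x ⁆ ∣ + k ≤ N
    room′ = ≤-trans (+-monoˡ-≤ k (∣p∪⁅x⁆∣≤1+∣p∣ B x)) (subst (_≤ N) (+-suc ∣ B ∣ k) room)
  ... | φ , chain , rainbow , above =
    B ◃ φ ,
    ◃-isChainCopy (λ j → B⊆φ j , λ B≡φj → x∉B (subst (x ∈_) (sym B≡φj) (x∈φ j))) chain ,
    ◃-rainbow {c = c} (λ j → fresh (x∈φ j) (proj₂ (above j))) rainbow ,
    λ { zero → ⊆-refl , room⇒≢⊤ B room ; (suc j) → B⊆φ j , proj₂ (above j) }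
    where
    B⊆φ : ∀ j → B ⊆ φ j
    B⊆φ j = proj₁ (above j) ∘ p⊆p∪q ⁅ x ⁆
    x∈φ : ∀ j → x ∈ φ j
    x∈φ j = proj₁ (above j) (q⊆p∪q B ⁅ x ⁆ (x∈⁅x⁆ x))

  rainbowChain : RainbowChain N c
  rainbowChain with rainbowChainAbove N ⊥ (≤-reflexive (cong (_+ N) (∣⊥∣≡0 N)))
  ... | φ , chain , rainbow , _ = φ , chain , rainbow

arrowsA2C-self : ∀ N → ArrowsA2Ck N N
arrowsA2C-self N c with monochromaticA2? c
... | yes monoA2 = inj₁ monoA2
... | no noA2    = inj₂ (Greedy.rainbowChain c noA2)

encode : Subset n → ℕᵇ
encode []            = 0ᵇ
encode (outside ∷ p) = 2[1+ encode p ]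
encode (inside  ∷ p) = 1+[2 encode p ]

encode-injective : {p q : Subset n} → encode p ≡ encode q → p ≡ q
encode-injective {p = []}          {[]}          _ = refl
encode-injective {p = outside ∷ p} {outside ∷ q} e = cong (outside ∷_) (encode-injective (2[1+_]-injective e))
encode-injective {p = inside  ∷ p} {inside  ∷ q} e = cong (inside ∷_) (encode-injective (1+[2_]-injective e))

ends-coloring : ∀ N → Coloring N
ends-coloring N X with X ≟ˢ ⊤
... | yes _ = ℕᵇ-toℕ (encode (⊥ {N}))
... | no  _ = ℕᵇ-toℕ (encode X)

ends-coloring-≢⊤ : (X : Subset N) → X ≢ ⊤ → ends-coloring N X ≡ ℕᵇ-toℕ (encode X)
ends-coloring-≢⊤ X X≢⊤ with X ≟ˢ ⊤
... | yes X≡⊤ = contradiction X≡⊤ X≢⊤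
... | no  _   = refl

ends-coloring-⊥≡⊤ : ∀ N → ends-coloring N ⊥ ≡ ends-coloring N ⊤
ends-coloring-⊥≡⊤ N with ⊥ {N} ≟ˢ ⊤ | ⊤ {N} ≟ˢ ⊤
... | _     | no ⊤≢⊤ = contradiction refl ⊤≢⊤
... | yes _ | yes _  = refl
... | no _  | yes _  = refl

ends-coloring-noA2 : ¬ MonochromaticA2 (ends-coloring N)
ends-coloring-noA2 {N} (X , Y , (X⊈Y , Y⊈X) , cX≡cY) = X⊈Y (⊆-reflexive X≡Y)
  where
  X≡Y : X ≡ Y
  X≡Y = encode-injective (ℕᵇ-toℕ-injective (begin
    ℕᵇ-toℕ (encode X) ≡⟨ sym (ends-coloring-≢⊤ X (λ { refl → Y⊈X ⊆⊤ })) ⟩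
    ends-coloring N X ≡⟨ cX≡cY ⟩
    ends-coloring N Y ≡⟨ ends-coloring-≢⊤ Y (λ { refl → X⊈Y ⊆⊤ }) ⟩
    ℕᵇ-toℕ (encode Y) ∎))
    where open ≡-Reasoning

ends-coloring-noRainbow : N ≤ suc k → ¬ RainbowChain (suc (suc k)) (ends-coloring N)
ends-coloring-noRainbow {N} {k} N≤1+k (φ , chain , rainbow)
  with chainCopy-spans N≤1+k chain
... | φ₀≡⊥ , φlast≡⊤ = rainbow zero (fromℕ (suc k)) (λ ()) (begin
  ends-coloring N (φ zero)             ≡⟨ cong (ends-coloring N) φ₀≡⊥ ⟩
  ends-coloring N ⊥                    ≡⟨ ends-coloring-⊥≡⊤ N ⟩
  ends-coloring N ⊤                    ≡⟨ cong (ends-coloring N) (sym φlast≡⊤) ⟩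
  ends-coloring N (φ (fromℕ (suc k))) ∎)
  where open ≡-Reasoning

¬arrowsA2C : N ≤ suc k → ¬ ArrowsA2Ck (suc (suc k)) N
¬arrowsA2C {N} N≤1+k arrows with arrows (ends-coloring N)
... | inj₁ monoA2  = ends-coloring-noA2 monoA2
... | inj₂ rainbow = ends-coloring-noRainbow N≤1+k rainbow

mainTheorem7 : (n : ℕ) → 2 ≤ n → RR-A2-C-is n n
mainTheorem7 (suc (suc k)) (s≤s (s≤s z≤n)) =
  s≤s z≤n , arrowsA2C-self (suc (suc k)) , λ N _ arrows → ≰⇒> (λ N≤1+k → ¬arrowsA2C N≤1+k arrows)
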